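{- Let $T$ be a tree with a root $z$ that is not a leaf, and let $U\subseteq V(T)$ be a smallest vertex cover of $T$ that minimises $\sum_{u\in U}\mathrm{dist}_T(u,z)$ among all smallest vertex covers of $T$. Let $(G_i)_{i\geq 0}$ be a $T$-process on some graph $G$, let $i_0\in\mathbb N$, and let $T_0\subseteq G_{i_0}$ be a copy of $T$ with an isomorphism $\varphi:T\to T_0$. Then in $G_{i_0+\lceil \mathrm{ht}_z(T)/2\rceil}$, every vertex of $\varphi(U)$ is adjacent to every vertex of $V(G)\setminus V(T_0)$.
   Context: For graphs $H$ and $G$, let $n_H(G)$ be the number of copies of $H$ in $G$. The $H$-process on a graph $G$ is the sequence $(G_i)_{i\geq0}$ with $G_0=G$, $V(G_i)=V(G)$ and $E(G_i)=E(G_{i-1})\cup\{e\in\binom{V(G)}{2}: n_H(G_{i-1}+e)>n_H(G_{i-1})\}$ for $i\ge1$. For root $z$ of $T$, the children of $u$ are its neighbours farther from $z$ than $u$; the height $\mathrm{ht}_z(u)$ is the length of a longest path $u=u_0u_1\dots u_\ell$ with each $u_i$ a child of $u_{i-1}$, and $\mathrm{ht}_z(T):=\mathrm{ht}_z(z)$. $\mathrm{dist}_T$ is graph distance in $T$. -}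

module Defs where

open import Data.Nat using (ℕ; zero; suc; _+_; _≤_; _<_; _≡ᵇ_; _<ᵇ_)
open import Data.Nat.DivMod using (_/_)
open import Data.Bool using (Bool; true; false; _∧_; _∨_; not; if_then_else_; T)
open import Data.Fin using (Fin; zero; suc; fromℕ; inject₁) renaming (_≟_ to _≟ᶠ_)
open import Data.Fin.Subset using (Subset; _∈_; ∣_∣)
open import Data.Vec using (Vec; []; _∷_; lookup)
open import Data.List using (List; []; _∷_; [_]; map; concatMap; allFin)
open import Data.Nat.ListAction using (sum)
open import Data.Bool.ListAction using (all)
open import Data.Product using (Σ; _×_)
open import Data.Sum using (_⊎_)
open import Relation.Nullary using (¬_; does)
open import Relation.Binary.PropositionalEquality using (_≡_)
open import Function.Definitions using (Injective)

Adj : ℕ → Set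
Adj n = Fin n → Fin n → Bool

record Graph (n : ℕ) : Set where
  field
    adj    : Adj n
    sym    : ∀ u v → adj u v ≡ adj v u
    irrefl : ∀ u → adj u u ≡ false
open Graph public

_==ᶠ_ : ∀ {n} → Fin n → Fin n → Bool
x ==ᶠ y = does (x ≟ᶠ y)

countTrue : List Bool → ℕ
countTrue []            = 0
countTrue (true  ∷ bs)  = suc (countTrue bs)
countTrue (false ∷ bs)  = countTrue bs

allMaps : ∀ h n → List (Vec (Fin n) h)
allMaps zero    n = [ [] ]
allMaps (suc h) n = concatMap (λ x → map (x ∷_) (allMaps h n)) (allFin n)

isEmbedding : ∀ {h n} → Adj h → Adj n → Vec (Fin n) h → Bool
isEmbedding {h} H A v =
  all (λ i → all (λ j →
        (not (lookup v i ==ᶠ lookup v j) ∨ (i ==ᶠ j))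
      ∧ (not (H i j) ∨ A (lookup v i) (lookup v j))) (allFin h)) (allFin h)

nEmb : ∀ {h n} → Adj h → Adj n → ℕ
nEmb {h} {n} H A = countTrue (map (isEmbedding H A) (allMaps h n))

-- n_H(G): number of copies of H in G, i.e. subgraphs of G isomorphic to H.
-- Each copy is the image of exactly |Aut(H)| = nEmb H H embeddings.
-- (nEmb H H ≥ 1 because of the identity; the zero case never occurs.)
nCopies : ∀ {h n} → Adj h → Adj n → ℕ
nCopies H A with nEmb H H
... | zero  = 0
... | suc a = nEmb H A / suc a

addEdge : ∀ {n} → Adj n → Fin n → Fin n → Adj n
addEdge A u v x y = A x y ∨ (((x ==ᶠ u) ∧ (y ==ᶠ v)) ∨ ((x ==ᶠ v) ∧ (y ==ᶠ u)))

processStep : ∀ {h n} → Adj h → Adj n → Adj n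
processStep H A u v =
  A u v ∨ (not (u ==ᶠ v) ∧ (nCopies H A <ᵇ nCopies H (addEdge A u v)))

process : ∀ {h n} → Adj h → Adj n → ℕ → Adj n
process H A zero    = A
process H A (suc i) = processStep H (process H A i)

Walk : ∀ {t} → Adj t → ℕ → Fin t → Fin t → Set
Walk {t} A k u v =
  Σ (Fin (suc k) → Fin t) λ p →
    (p zero ≡ u) × (p (fromℕ k) ≡ v) × (∀ (i : Fin k) → T (A (p (inject₁ i)) (p (suc i))))

Connected : ∀ {t} → Adj t → Set
Connected {t} A = ∀ (u v : Fin t) → Σ ℕ λ k → Walk A k u v

HasCycle : ∀ {t} → Adj t → Set
HasCycle {t} A =
  Σ ℕ λ m → Σ (Fin (suc (suc (suc m))) → Fin t) λ p →
    Injective _≡_ _≡_ p ×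
    (∀ (i : Fin (suc (suc m))) → T (A (p (inject₁ i)) (p (suc i)))) ×
    T (A (p (fromℕ (suc (suc m)))) (p zero))

IsTree : ∀ {t} → Graph t → Set
IsTree T' = Connected (adj T') × ¬ HasCycle (adj T')

degree : ∀ {t} → Adj t → Fin t → ℕ
degree {t} A u = countTrue (map (A u) (allFin t))

IsLeaf : ∀ {t} → Adj t → Fin t → Set
IsLeaf A u = degree A u ≡ 1

IsDistFrom : ∀ {t} → Adj t → Fin t → (Fin t → ℕ) → Set
IsDistFrom {t} A z d =
  ∀ (u : Fin t) → Walk A (d u) z u × (∀ k → Walk A k z u → d u ≤ k)

IsChild : ∀ {t} → Adj t → (Fin t → ℕ) → Fin t → Fin t → Set
IsChild A d u v = T (A u v) × d u < d v

DescPath : ∀ {t} → Adj t → (Fin t → ℕ) → Fin t → ℕ → Set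
DescPath {t} A d u ℓ =
  Σ (Fin (suc ℓ) → Fin t) λ p →
    (p zero ≡ u) × (∀ (i : Fin ℓ) → IsChild A d (p (inject₁ i)) (p (suc i)))

IsHeight : ∀ {t} → Adj t → (Fin t → ℕ) → Fin t → ℕ → Set
IsHeight A d z h = DescPath A d z h × (∀ ℓ → DescPath A d z ℓ → ℓ ≤ h)

IsVertexCover : ∀ {t} → Adj t → Subset t → Set
IsVertexCover A U = ∀ u v → T (A u v) → u ∈ U ⊎ v ∈ U

IsSmallestVertexCover : ∀ {t} → Adj t → Subset t → Set
IsSmallestVertexCover {t} A U =
  IsVertexCover A U × (∀ (U' : Subset t) → IsVertexCover A U' → ∣ U ∣ ≤ ∣ U' ∣)

sumOver : ∀ {t} → Subset t → (Fin t → ℕ) → ℕ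
sumOver {t} U d = sum (map (λ u → if lookup U u then d u else 0) (allFin t))

{-# OPTIONS --safe #-}

-- Every u ∈ U has a child x ∉ U: otherwise U − u would be a smaller cover, or u could be
-- exchanged for its parent, lowering Σ_{u∈U} dist(u, z).  The other neighbours of x are
-- grandchildren of u and lie in U.  Once they are all joined to an outside vertex w,
-- moving φ(x) to w gives a copy of T in G_i + φ(u)w which is not a copy in G_i unless
-- φ(u)w is already present; since a new copy strictly increases n_T, the process adds
-- φ(u)w in the next step.  As ht − dist(u, z) drops by two from u to its grandchildren,
-- induction gives the bound ⌈ht/2⌉.

module Submission where

open import Defs hiding (sym)
open import Data.Nat
  using (ℕ; zero; suc; pred; _+_; _∸_; _≤_; _<_; _<?_; ⌈_/2⌉; ⌊_/2⌋; z≤n; s≤s; NonZero; ≤′-refl; ≤′-step)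
open import Data.Nat.Properties
open import Data.Nat.Tactic.RingSolver using (solve-∀)
open import Data.Nat.DivMod using (_/_; /-monoˡ-≤; +-distrib-/-∣ʳ; n/n≡1)
open import Data.Nat.Divisibility using (∣-refl)
open import Data.Bool using (Bool; true; false; _∧_; _∨_; not; T; if_then_else_)
open import Data.Bool.Properties using (T-∧; T-∨)
open import Data.Bool.ListAction using (all)
open import Data.Unit using (⊤; tt)
open import Data.Empty using (⊥; ⊥-elim)
open import Data.Fin using (Fin; zero; suc; fromℕ; inject₁; punchIn; punchOut) renaming (_≟_ to _≟ᶠ_)
open import Data.Fin.Properties using (any?; injective⇒≤; punchOut-injective; punchInᵢ≢i)
import Data.Fin.Permutation as Perm
open import Data.Vec using (Vec; []; _∷_; lookup; tabulate; _[_]≔_)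
open import Data.Vec.Properties
  using ( lookup∘tabulate; tabulate∘lookup; tabulate-cong; ∷-injectiveˡ; ∷-injectiveʳ
        ; lookup∘update; lookup∘update′; []=⇒lookup; lookup⇒[]=)
open import Data.Vec.Functional using (removeAt)
open import Data.Fin.Subset using (Subset; _∈_; _∉_; ∣_∣)
open import Data.Fin.Subset.Properties using (_∈?_)
open import Data.Nat.ListAction using () renaming (sum to sumˡ)
open import Data.List using (List; []; _∷_; map; allFin; length; filterᵇ)
import Data.List
import Data.List.Properties as List
open import Data.List.Membership.Propositional using () renaming (_∈_ to _∈ˡ_)
open import Data.List.Membership.Propositional.Properties
  using (∈-allFin; ∈-lookup; ∈-map⁺; ∈-map⁻; ∈-concatMap⁺; ∈-filter⁺; ∈-filter⁻)
open import Data.List.Relation.Unary.Any as Any using (here; there; index)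
open import Data.List.Relation.Unary.Any.Properties using (lookup-index)
import Data.List.Relation.Unary.All as All
import Data.List.Relation.Unary.All.Properties as All
open import Data.List.Relation.Unary.AllPairs using (_∷_)
import Data.List.Relation.Unary.AllPairs as AllPairs
import Data.List.Relation.Unary.AllPairs.Properties as AllPairs
open import Data.List.Relation.Unary.Unique.Propositional using (Unique)
open import Data.List.Relation.Binary.Disjoint.Propositional using (Disjoint)
import Data.List.Relation.Unary.Unique.Propositional.Properties as Unique
open import Algebra.Properties.CommutativeMonoid.Sum +-0-commutativeMonoid
  using (sum-remove; sum-permute; sum-cong-≗) renaming (sum to ∑)
open import Data.Product using (Σ; ∃; _×_; _,_; proj₁; proj₂; swap)
open import Data.Sum using (_⊎_; inj₁; inj₂)
open import Function using (_∘_; _$_; case_of_; _⇔_; mk⇔; Equivalence)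
open import Function.Definitions using (Injective)
open import Relation.Nullary using (¬_; yes; no; contradiction)
open import Relation.Nullary.Decidable using (T?; _×-dec_; ¬?; decidable-stable)
open import Relation.Binary.PropositionalEquality
open Equivalence using (to; from)

private
  variable
    h n : ℕ

T-==ᶠ : {x y : Fin n} → T (x ==ᶠ y) ⇔ x ≡ y
T-==ᶠ {x = x} {y} with x ≟ᶠ y
... | yes x≡y = mk⇔ (λ _ → x≡y) (λ _ → tt)
... | no x≢y  = mk⇔ (λ ()) x≢y

T-not : ∀ {b} → T (not b) ⇔ (¬ T b)
T-not {true}  = mk⇔ (λ ()) (λ ¬b → ¬b tt)
T-not {false} = mk⇔ (λ _ ()) (λ _ → tt)

T-not-∨ : ∀ {b c} → T (not b ∨ c) ⇔ (T b → T c)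
T-not-∨ {true}  = mk⇔ (λ c _ → c) (λ f → f tt)
T-not-∨ {false} = mk⇔ (λ _ ()) (λ _ → tt)

T-all-allFin : {p : Fin n → Bool} → T (all p (allFin n)) ⇔ (∀ i → T (p i))
T-all-allFin {n} {p} = mk⇔
  (λ all-p i → All.lookup (All.all⁺ p (allFin n) all-p) (∈-allFin i))
  (λ p-holds → All.all⁻ p {allFin n} (All.tabulate (λ {i} _ → p-holds i)))

-- Embeddings, and the growth of n_H under adding an edge

record IsEmbedding (H : Adj h) (A : Adj n) (f : Fin h → Fin n) : Set where
  constructor embedding
  field
    injective   : Injective _≡_ _≡_ f
    homomorphic : ∀ i j → T (H i j) → T (A (f i) (f j))
open IsEmbedding

IsEmbedding-cong : {H : Adj h} {A : Adj n} {f g : Fin h → Fin n} →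
                   f ≗ g → IsEmbedding H A f → IsEmbedding H A g
IsEmbedding-cong {A = A} f≗g (embedding f-inj f-hom) = embedding
  (λ {i} {j} eq → f-inj (trans (f≗g i) (trans eq (sym (f≗g j)))))
  (λ i j e → subst₂ (λ a b → T (A a b)) (f≗g i) (f≗g j) (f-hom i j e))

IsEmbedding-mono : {H : Adj h} {A B : Adj n} {f : Fin h → Fin n} →
                   (∀ a b → T (A a b) → T (B a b)) → IsEmbedding H A f → IsEmbedding H B f
IsEmbedding-mono A⊆B (embedding f-inj f-hom) = embedding f-inj λ i j e → A⊆B _ _ (f-hom i j e)

IsEmbedding-∘ : {H : Adj h} {A : Adj n} {σ : Fin h → Fin h} {f : Fin h → Fin n} →
                IsEmbedding H H σ → IsEmbedding H A f → IsEmbedding H A (f ∘ σ)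
IsEmbedding-∘ (embedding σ-inj σ-hom) (embedding f-inj f-hom) =
  embedding (σ-inj ∘ f-inj) λ i j e → f-hom _ _ (σ-hom i j e)

T-isEmbedding : (H : Adj h) (A : Adj n) (v : Vec (Fin n) h) →
                T (isEmbedding H A v) ⇔ IsEmbedding H A (lookup v)
T-isEmbedding H A v = mk⇔
  (λ e → embedding (λ {i} {j} → proj₁ (pair e i j)) (λ i j → proj₂ (pair e i j)))
  (λ (embedding inj hom) → from T-all-allFin λ i → from T-all-allFin λ j →
     from T-∧ (from T-not-∨ (from T-==ᶠ ∘ inj ∘ to T-==ᶠ) , from T-not-∨ (hom i j)))
  where
  pair : T (isEmbedding H A v) → ∀ i j →
         (lookup v i ≡ lookup v j → i ≡ j) × (T (H i j) → T (A (lookup v i) (lookup v j)))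
  pair e i j with to T-∧ (to T-all-allFin (to T-all-allFin e i) j)
  ... | distinct , edges = to T-==ᶠ ∘ to T-not-∨ distinct ∘ from T-==ᶠ , to T-not-∨ edges

Unique-lookup-injective : ∀ {A : Set} {xs : List A} → Unique xs → Injective _≡_ _≡_ (Data.List.lookup xs)
Unique-lookup-injective (_    ∷ _)         {zero}  {zero}  _  = refl
Unique-lookup-injective (x∉xs ∷ _)         {zero}  {suc j} eq = ⊥-elim (All.lookup x∉xs (∈-lookup j) eq)
Unique-lookup-injective (x∉xs ∷ _)         {suc i} {zero}  eq = ⊥-elim (All.lookup x∉xs (∈-lookup i) (sym eq))
Unique-lookup-injective (_    ∷ xs-unique) {suc i} {suc j} eq = cong suc (Unique-lookup-injective xs-unique eq)

Unique-⊆⇒length≤ : ∀ {A : Set} {xs ys : List A} → Unique xs → (∀ {x} → x ∈ˡ xs → x ∈ˡ ys) →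
                   length xs ≤ length ys
Unique-⊆⇒length≤ {xs = xs} {ys} xs-unique xs⊆ys = injective⇒≤ position-injective
  where
  position : Fin (length xs) → Fin (length ys)
  position i = index (xs⊆ys (∈-lookup i))
  position-injective : Injective _≡_ _≡_ position
  position-injective {i} {j} eq = Unique-lookup-injective xs-unique
    (trans (lookup-index (xs⊆ys (∈-lookup i)))
      (trans (cong (Data.List.lookup ys) eq) (sym (lookup-index (xs⊆ys (∈-lookup j))))))

countTrue-map : ∀ {A : Set} (p : A → Bool) xs → countTrue (map p xs) ≡ length (filterᵇ p xs)
countTrue-map p []       = refl
countTrue-map p (x ∷ xs) with p x
... | true  = cong suc (countTrue-map p xs)
... | false = countTrue-map p xs

countTrue-split : ∀ {A : Set} (p q : A → Bool) xs → (∀ x → T (p x) → T (q x)) →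
                  countTrue (map q xs) ≡
                  countTrue (map p xs) + countTrue (map (λ x → q x ∧ not (p x)) xs)
countTrue-split p q []       p⇒q = refl
countTrue-split p q (x ∷ xs) p⇒q with p x | q x | p⇒q x
... | true  | true  | _    = cong suc (countTrue-split p q xs p⇒q)
... | true  | false | p⇒qx = ⊥-elim (p⇒qx tt)
... | false | true  | _    = trans (cong suc (countTrue-split p q xs p⇒q)) (sym (+-suc _ _))
... | false | false | _    = countTrue-split p q xs p⇒q

countTrue-pos : ∀ {A : Set} (p : A → Bool) {xs x} → x ∈ˡ xs → T (p x) → 0 < countTrue (map p xs)
countTrue-pos p {y ∷ _} x∈xs px with p y in py
... | true  = s≤s z≤n
countTrue-pos p (here refl) px | false = ⊥-elim (subst T py px)
countTrue-pos p (there x∈xs) px | false = countTrue-pos p x∈xs px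

countTrue-≤-injection : ∀ {A B : Set} (p : A → Bool) (q : B → Bool) {xs ys} (ι : A → B) →
                        Unique xs → Injective _≡_ _≡_ ι →
                        (∀ {x} → x ∈ˡ xs → T (p x) → ι x ∈ˡ ys × T (q (ι x))) →
                        countTrue (map p xs) ≤ countTrue (map q ys)
countTrue-≤-injection p q {xs} {ys} ι xs-unique ι-inj good = begin
  countTrue (map p xs)            ≡⟨ countTrue-map p xs ⟩
  length (filterᵇ p xs)           ≡⟨ List.length-map ι (filterᵇ p xs) ⟨
  length (map ι (filterᵇ p xs))   ≤⟨ Unique-⊆⇒length≤ image-unique image⊆ ⟩
  length (filterᵇ q ys)           ≡⟨ countTrue-map q ys ⟨
  countTrue (map q ys)            ∎
  where
  open ≤-Reasoning
  image-unique : Unique (map ι (filterᵇ p xs))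
  image-unique = Unique.map⁺ ι-inj (Unique.filter⁺ (T? ∘ p) xs-unique)
  image⊆ : ∀ {y} → y ∈ˡ map ι (filterᵇ p xs) → y ∈ˡ filterᵇ q ys
  image⊆ y∈ with ∈-map⁻ ι y∈
  ... | x , x∈ , refl with ∈-filter⁻ (T? ∘ p) x∈
  ...   | x∈xs , px = ∈-filter⁺ (T? ∘ q) (proj₁ (good x∈xs px)) (proj₂ (good x∈xs px))

∈-allMaps : ∀ {h n} (v : Vec (Fin n) h) → v ∈ˡ allMaps h n
∈-allMaps []      = here refl
∈-allMaps (x ∷ v) = ∈-concatMap⁺ (λ y → map (y ∷_) (allMaps _ _))
  (Any.map (λ { refl → ∈-map⁺ (x ∷_) (∈-allMaps v) }) (∈-allFin x))

allMaps-unique : ∀ h n → Unique (allMaps h n)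
allMaps-unique zero    n = All.[] ∷ AllPairs.[]
allMaps-unique (suc h) n = Unique.concat⁺
  (All.map⁺ (All.tabulate λ _ → Unique.map⁺ ∷-injectiveʳ (allMaps-unique h n)))
  (AllPairs.map⁺ (AllPairs.map disjoint (Unique.allFin⁺ n)))
  where
  disjoint : ∀ {x y : Fin n} → x ≢ y →
             Disjoint (map (x ∷_) (allMaps h n)) (map (y ∷_) (allMaps h n))
  disjoint {x} {y} x≢y (v∈x , v∈y) with ∈-map⁻ (x ∷_) v∈x | ∈-map⁻ (y ∷_) v∈y
  ... | _ , _ , refl | _ , _ , eq = x≢y (∷-injectiveˡ eq)

∑-mono-≤ : {f g : Fin n → ℕ} → (∀ i → f i ≤ g i) → ∑ f ≤ ∑ g
∑-mono-≤ {zero}  f≤g = z≤n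
∑-mono-≤ {suc n} f≤g = +-mono-≤ (f≤g zero) (∑-mono-≤ (f≤g ∘ suc))

∑-mono-< : {f g : Fin n → ℕ} → (∀ i → f i ≤ g i) → ∀ i → f i < g i → ∑ f < ∑ g
∑-mono-< {suc n} {f} {g} f≤g i fi<gi = begin-strict
  ∑ f                     ≡⟨ sum-remove {i = i} f ⟩
  f i + ∑ (removeAt f i)  <⟨ +-mono-<-≤ fi<gi (∑-mono-≤ (f≤g ∘ punchIn i)) ⟩
  g i + ∑ (removeAt g i)  ≡⟨ sum-remove {i = i} g ⟨
  ∑ g                     ∎
  where open ≤-Reasoning

∑-agree-off : (f g : Fin n → ℕ) (i : Fin n) → (∀ j → j ≢ i → f j ≡ g j) → ∑ f + g i ≡ ∑ g + f i
∑-agree-off {suc n} f g i agree = begin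
  ∑ f + g i                    ≡⟨ cong (_+ g i) (sum-remove {i = i} f) ⟩
  f i + ∑ (removeAt f i) + g i ≡⟨ cong (λ s → f i + s + g i) (sum-cong-≗ (agree _ ∘ punchInᵢ≢i i)) ⟩
  f i + ∑ (removeAt g i) + g i ≡⟨ +-comm-middle (f i) (∑ (removeAt g i)) (g i) ⟩
  g i + ∑ (removeAt g i) + f i ≡⟨ cong (_+ f i) (sum-remove {i = i} g) ⟨
  ∑ g + f i                    ∎
  where
  open ≡-Reasoning
  +-comm-middle : ∀ a s b → a + s + b ≡ b + s + a
  +-comm-middle = solve-∀

injective⇒surjective : {σ : Fin n → Fin n} → Injective _≡_ _≡_ σ → ∀ j → ∃ λ i → σ i ≡ j
injective⇒surjective {suc n} {σ} σ-inj j with any? (λ i → σ i ≟ᶠ j)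
... | yes hit  = hit
... | no  miss = contradiction (injective⇒≤ squeeze-injective) 1+n≰n
  where
  j≢σ : ∀ i → j ≢ σ i
  j≢σ i eq = miss (i , sym eq)
  squeeze : Fin (suc n) → Fin n
  squeeze i = punchOut (j≢σ i)
  squeeze-injective : Injective _≡_ _≡_ squeeze
  squeeze-injective eq = σ-inj (punchOut-injective (j≢σ _) (j≢σ _) eq)

∑-∘-injective : {σ : Fin n → Fin n} → Injective _≡_ _≡_ σ → (f : Fin n → ℕ) → ∑ (f ∘ σ) ≡ ∑ f
∑-∘-injective {n} {σ} σ-inj f = sym (sum-permute f π)
  where
  σ⁻¹ : Fin n → Fin n
  σ⁻¹ j = proj₁ (injective⇒surjective σ-inj j)
  π : Perm.Permutation _ _
  π = Perm.permutation σ σ⁻¹ (λ j → proj₂ (injective⇒surjective σ-inj j))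
                             (λ i → σ-inj (proj₂ (injective⇒surjective σ-inj (σ i))))

-- σ is a bijection, so it preserves the number of edges; an edge it creates would add one.
selfEmbedding-reflects : (H : Adj n) {σ : Fin n → Fin n} → IsEmbedding H H σ →
                         ∀ i j → T (H (σ i) (σ j)) → T (H i j)
selfEmbedding-reflects H {σ} (embedding σ-inj σ-hom) i j σij with T? (H i j)
... | yes ij = ij
... | no ¬ij = ⊥-elim $ <-irrefl edges∘σ≡edges (∑-mono-< (λ k → ∑-mono-≤ (edge≤ k)) i
                                           (∑-mono-< (edge≤ i) j (edge< ¬ij σij)))
  where
  edge : Bool → ℕ
  edge b = if b then 1 else 0
  edge-mono : ∀ {a b} → (T a → T b) → edge a ≤ edge b
  edge-mono {false}         _   = z≤n
  edge-mono {true}  {true}  _   = ≤-refl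
  edge-mono {true}  {false} a⇒b = ⊥-elim (a⇒b tt)
  edge≤ : ∀ k l → edge (H k l) ≤ edge (H (σ k) (σ l))
  edge≤ k l = edge-mono (σ-hom k l)
  edge< : ∀ {a b} → ¬ T a → T b → edge a < edge b
  edge< {false} {true} _ _ = s≤s z≤n
  edge< {true}         ¬a _ = contradiction tt ¬a
  edges∘σ≡edges : ∑ (λ k → ∑ (λ l → edge (H k l))) ≡ ∑ (λ k → ∑ (λ l → edge (H (σ k) (σ l))))
  edges∘σ≡edges = sym (trans (sum-cong-≗ (λ k → ∑-∘-injective σ-inj (λ l → edge (H (σ k) l))))
                             (∑-∘-injective σ-inj (λ k → ∑ (λ l → edge (H k l)))))

IsEmbedding-∘⁻¹ : {H : Adj h} {A : Adj n} {σ : Fin h → Fin h} {f : Fin h → Fin n} →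
                  IsEmbedding H H σ → Injective _≡_ _≡_ f →
                  IsEmbedding H A (f ∘ σ) → IsEmbedding H A f
IsEmbedding-∘⁻¹ {H = H} {A} {σ} {f} σ-emb f-inj fσ-emb = embedding f-inj hom
  where
  hom : ∀ i j → T (H i j) → T (A (f i) (f j))
  hom i j e with injective⇒surjective (injective σ-emb) i | injective⇒surjective (injective σ-emb) j
  ... | i′ , refl | j′ , refl = homomorphic fσ-emb i′ j′ (selfEmbedding-reflects H σ-emb i′ j′ e)

m+n≤o⇒m/n<o/n : ∀ {m n o} .{{_ : NonZero n}} → m + n ≤ o → m / n < o / n
m+n≤o⇒m/n<o/n {m} {n} {o} m+n≤o = begin-strict
  m / n            <⟨ n<1+n (m / n) ⟩
  suc (m / n)      ≡⟨ +-comm 1 (m / n) ⟩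
  m / n + 1        ≡⟨ cong (m / n +_) (n/n≡1 n) ⟨
  m / n + n / n    ≡⟨ +-distrib-/-∣ʳ m ∣-refl ⟨
  (m + n) / n      ≤⟨ /-monoˡ-≤ n m+n≤o ⟩
  o / n            ∎
  where open ≤-Reasoning

addEdge-⊇ : (A : Adj n) (a b : Fin n) → ∀ x y → T (A x y) → T (addEdge A a b x y)
addEdge-⊇ A a b x y e = from T-∨ (inj₁ e)

nEmb-self-pos : (H : Adj h) → 0 < nEmb H H
nEmb-self-pos {h} H = countTrue-pos (isEmbedding H H) (∈-allMaps identity)
  (from (T-isEmbedding H H identity) (IsEmbedding-cong (sym ∘ lookup∘tabulate (λ i → i)) id-embedding))
  where
  identity : Vec (Fin h) h
  identity = tabulate (λ i → i)
  id-embedding : IsEmbedding H H (λ i → i)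
  id-embedding = embedding (λ eq → eq) (λ i j e → e)

-- Composing ψ with the automorphisms of H gives nEmb H H embeddings into A + ab that are
-- not embeddings into A; copies are embeddings counted up to automorphisms.
module _ {t n} (H : Adj t) (A : Adj n) {a b : Fin n} {ψ : Fin t → Fin n}
         (ψ-emb : IsEmbedding H (addEdge A a b) ψ) (ψ-not-emb : ¬ IsEmbedding H A ψ) where

  private
    A⁺ : Adj n
    A⁺ = addEdge A a b
    relabel : Vec (Fin t) t → Vec (Fin n) t
    relabel σ = tabulate (ψ ∘ lookup σ)
    relabel-lookup : ∀ σ → ψ ∘ lookup σ ≗ lookup (relabel σ)
    relabel-lookup σ i = sym (lookup∘tabulate (ψ ∘ lookup σ) i)
    relabel-injective : Injective _≡_ _≡_ relabel
    relabel-injective {σ} {σ′} eq = begin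
      σ                    ≡⟨ tabulate∘lookup σ ⟨
      tabulate (lookup σ)  ≡⟨ tabulate-cong (λ i → injective ψ-emb (trans (relabel-lookup σ i)
                                (trans (cong (λ v → lookup v i) eq) (sym (relabel-lookup σ′ i))))) ⟩
      tabulate (lookup σ′) ≡⟨ tabulate∘lookup σ′ ⟩
      σ′                   ∎
      where open ≡-Reasoning
    new : Vec (Fin n) t → Bool
    new v = isEmbedding H A⁺ v ∧ not (isEmbedding H A v)
    relabel-new : ∀ {σ} → σ ∈ˡ allMaps t t → T (isEmbedding H H σ) →
                  relabel σ ∈ˡ allMaps t n × T (new (relabel σ))
    relabel-new {σ} _ σ-aut = ∈-allMaps (relabel σ) , from T-∧ (into-A⁺ , from T-not not-into-A)
      where
      σ-emb : IsEmbedding H H (lookup σ)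
      σ-emb = to (T-isEmbedding H H σ) σ-aut
      into-A⁺ : T (isEmbedding H A⁺ (relabel σ))
      into-A⁺ = from (T-isEmbedding H A⁺ (relabel σ))
                  (IsEmbedding-cong (relabel-lookup σ) (IsEmbedding-∘ σ-emb ψ-emb))
      not-into-A : ¬ T (isEmbedding H A (relabel σ))
      not-into-A = ψ-not-emb ∘ IsEmbedding-∘⁻¹ σ-emb (injective ψ-emb)
                 ∘ IsEmbedding-cong (sym ∘ relabel-lookup σ) ∘ to (T-isEmbedding H A (relabel σ))

  nEmb-addEdge : nEmb H A + nEmb H H ≤ nEmb H A⁺
  nEmb-addEdge = begin
    nEmb H A + nEmb H H                           ≤⟨ +-monoʳ-≤ (nEmb H A) automorphisms-relabelled ⟩
    nEmb H A + countTrue (map new (allMaps t n))  ≡⟨ countTrue-split (isEmbedding H A) (isEmbedding H A⁺)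
                                                                      (allMaps t n) into-A⇒into-A⁺ ⟨
    nEmb H A⁺                                     ∎
    where
    open ≤-Reasoning
    automorphisms-relabelled : nEmb H H ≤ countTrue (map new (allMaps t n))
    automorphisms-relabelled = countTrue-≤-injection (isEmbedding H H) new relabel
                                 (allMaps-unique t t) relabel-injective relabel-new
    into-A⇒into-A⁺ : ∀ v → T (isEmbedding H A v) → T (isEmbedding H A⁺ v)
    into-A⇒into-A⁺ v = from (T-isEmbedding H A⁺ v) ∘ IsEmbedding-mono (addEdge-⊇ A a b)
                       ∘ to (T-isEmbedding H A v)

  nCopies-addEdge : nCopies H A < nCopies H A⁺
  nCopies-addEdge with nEmb H H | nEmb-self-pos H | nEmb-addEdge
  ... | suc c | _ | bound = m+n≤o⇒m/n<o/n bound

-- Walks and rooted trees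

adjacent⇒≢ : (A : Adj n) → (∀ u → A u u ≡ false) → ∀ {x y} → T (A x y) → x ≢ y
adjacent⇒≢ A A-irrefl {x} e refl = subst T (A-irrefl x) e

module Walks {t} (A : Adj t) (A-sym : ∀ u v → A u v ≡ A v u) where

  infixr 5 _◅_
  data IWalk : ℕ → Fin t → Fin t → Set where
    nil : ∀ a → IWalk 0 a a
    _◅_ : ∀ {k a b c} → T (A a b) → IWalk k b c → IWalk (suc k) a c

  private
    variable
      k l : ℕ
      a b c x : Fin t

  flipEdge : T (A a b) → T (A b a)
  flipEdge {a} {b} = subst T (A-sym a b)

  vertexAt : IWalk k a c → Fin (suc k) → Fin t
  vertexAt (nil a)              zero    = a
  vertexAt (_◅_ {a = a} e w)    zero    = a
  vertexAt (e ◅ w)              (suc i) = vertexAt w i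

  vertexAt-first : (w : IWalk k a c) → vertexAt w zero ≡ a
  vertexAt-first (nil a) = refl
  vertexAt-first (e ◅ w) = refl

  vertexAt-last : (w : IWalk k a c) → vertexAt w (fromℕ k) ≡ c
  vertexAt-last (nil a) = refl
  vertexAt-last (e ◅ w) = vertexAt-last w

  vertexAt-edge : (w : IWalk k a c) (i : Fin k) → T (A (vertexAt w (inject₁ i)) (vertexAt w (suc i)))
  vertexAt-edge (e ◅ w) zero    = subst (T ∘ A _) (sym (vertexAt-first w)) e
  vertexAt-edge (e ◅ w) (suc i) = vertexAt-edge w i

  toWalk : IWalk k a c → Walk A k a c
  toWalk w = vertexAt w , vertexAt-first w , vertexAt-last w , vertexAt-edge w

  fromWalk : Walk A k a c → IWalk k a c
  fromWalk {zero}  (p , refl , refl , _) = nil (p zero)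
  fromWalk {suc k} (p , refl , p-last , p-edge) =
    p-edge zero ◅ fromWalk ((p ∘ suc) , refl , p-last , p-edge ∘ suc)

  _▻_ : IWalk k a b → T (A b c) → IWalk (suc k) a c
  nil a   ▻ e = e ◅ nil _
  (f ◅ w) ▻ e = f ◅ (w ▻ e)

  reverse : IWalk k a c → IWalk k c a
  reverse (nil a) = nil a
  reverse (e ◅ w) = reverse w ▻ flipEdge e

  _++_ : IWalk k a b → IWalk l b c → IWalk (k + l) a c
  nil a   ++ v = v
  (e ◅ w) ++ v = e ◅ (w ++ v)

  unsnoc : IWalk (suc k) a c → ∃ λ b → IWalk k a b × T (A b c)
  unsnoc (e ◅ nil _)   = _ , nil _ , e
  unsnoc (e ◅ f ◅ w) with unsnoc (f ◅ w)
  ... | b , w′ , e′ = b , e ◅ w′ , e′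

  Avoids : Fin t → IWalk k a c → Set
  Avoids x (nil a)           = a ≢ x
  Avoids x (_◅_ {a = a} e w) = a ≢ x × Avoids x w

  avoids-▻ : (w : IWalk k a b) (e : T (A b c)) → Avoids x w → c ≢ x → Avoids x (w ▻ e)
  avoids-▻ (nil a) e a≢x c≢x         = a≢x , c≢x
  avoids-▻ (f ◅ w) e (a≢x , w-x) c≢x = a≢x , avoids-▻ w e w-x c≢x

  avoids-reverse : (w : IWalk k a c) → Avoids x w → Avoids x (reverse w)
  avoids-reverse (nil a) a≢x         = a≢x
  avoids-reverse (e ◅ w) (a≢x , w-x) = avoids-▻ (reverse w) (flipEdge e) (avoids-reverse w w-x) a≢x

  avoids-++ : (w : IWalk k a b) (v : IWalk l b c) → Avoids x w → Avoids x v → Avoids x (w ++ v)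
  avoids-++ (nil a) v _             v-x = v-x
  avoids-++ (e ◅ w) v (a≢x , w-x) v-x = a≢x , avoids-++ w v w-x v-x

  avoids-vertexAt : (w : IWalk k a c) → Avoids x w → ∀ i → vertexAt w i ≢ x
  avoids-vertexAt (nil a) a≢x         zero    = a≢x
  avoids-vertexAt (e ◅ w) (a≢x , _)   zero    = a≢x
  avoids-vertexAt (e ◅ w) (_ , w-x)   (suc i) = avoids-vertexAt w w-x i

  IsPath : IWalk k a c → Set
  IsPath (nil a)           = ⊤
  IsPath (_◅_ {a = a} e w) = Avoids a w × IsPath w

  path-injective : (w : IWalk k a c) → IsPath w → Injective _≡_ _≡_ (vertexAt w)
  path-injective (nil a) _             {zero}  {zero}  _  = refl
  path-injective (e ◅ w) _             {zero}  {zero}  _  = refl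
  path-injective (e ◅ w) (w-a , _)     {zero}  {suc j} eq = contradiction (sym eq) (avoids-vertexAt w w-a j)
  path-injective (e ◅ w) (w-a , _)     {suc i} {zero}  eq = contradiction eq (avoids-vertexAt w w-a i)
  path-injective (e ◅ w) (_ , w-path)  {suc i} {suc j} eq = cong suc (path-injective w w-path eq)

  SuffixFrom : IWalk k a c → Fin t → Set
  SuffixFrom {c = c} w x =
    ∃ λ l → Σ (IWalk l x c) λ v → (IsPath w → IsPath v) × (∀ y → Avoids y w → Avoids y v)

  dropUntil : ∀ x (w : IWalk k a c) → Avoids x w ⊎ SuffixFrom w x
  dropUntil x (nil a) with a ≟ᶠ x
  ... | yes refl = inj₂ (_ , nil a , (λ p → p) , λ _ w-y → w-y)
  ... | no a≢x   = inj₁ a≢x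
  dropUntil x (_◅_ {a = a} e w) with a ≟ᶠ x
  ... | yes refl = inj₂ (_ , e ◅ w , (λ p → p) , λ _ w-y → w-y)
  ... | no a≢x with dropUntil x w
  ...   | inj₁ w-x = inj₁ (a≢x , w-x)
  ...   | inj₂ (l , v , path⇒path , avoid⇒avoid) =
    inj₂ (l , v , path⇒path ∘ proj₂ , λ y → avoid⇒avoid y ∘ proj₂)

  toPath : (w : IWalk k a c) →
           ∃ λ l → Σ (IWalk l a c) λ v → IsPath v × (∀ y → Avoids y w → Avoids y v)
  toPath (nil a) = _ , nil a , tt , λ _ a≢y → a≢y
  toPath (_◅_ {a = a} e w) with toPath w
  ... | l , v , v-path , v-avoids with dropUntil a v
  ...   | inj₁ v-a = _ , e ◅ v , (v-a , v-path) , λ y (a≢y , w-y) → a≢y , v-avoids y w-y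
  ...   | inj₂ (l′ , v′ , path⇒path , avoid⇒avoid) =
    l′ , v′ , path⇒path v-path , λ y (_ , w-y) → avoid⇒avoid y (v-avoids y w-y)

  closePath : (w : IWalk (suc (suc k)) a c) → IsPath w → T (A c a) → HasCycle A
  closePath {k} w w-path ca = k , vertexAt w , path-injective w w-path , vertexAt-edge w ,
    subst₂ (λ u v → T (A u v)) (sym (vertexAt-last w)) (sym (vertexAt-first w)) ca

  acyclic⇒noDetour : ¬ HasCycle A → T (A x a) → T (A x c) → a ≢ c →
                     (w : IWalk k a c) → ¬ Avoids x w
  acyclic⇒noDetour {x} acyclic xa xc a≢c w w-x with toPath w
  ... | zero  , nil _ , _      , _        = a≢c refl
  ... | suc l , v     , v-path , v-avoids =
    acyclic (closePath (xa ◅ v) (v-avoids x w-x , v-path) (flipEdge xc))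

module RootedTree {t} (A : Adj t) (A-sym : ∀ u v → A u v ≡ A v u) (A-irrefl : ∀ u → A u u ≡ false)
                  (acyclic : ¬ HasCycle A) (z : Fin t) (d : Fin t → ℕ) (d-dist : IsDistFrom A z d) where

  open Walks A A-sym

  private
    variable
      j k : ℕ
      a c u v x y : Fin t

  dist-≤ : IWalk k z v → d v ≤ k
  dist-≤ {k} {v} w = proj₂ (d-dist v) k (toWalk w)

  geodesic : ∀ v → IWalk (d v) z v
  geodesic v = fromWalk (proj₁ (d-dist v))

  dist-root : d z ≡ 0
  dist-root = n≤0⇒n≡0 (dist-≤ (nil z))

  dist≡0⇒root : d v ≡ 0 → v ≡ z
  dist≡0⇒root {v} dv≡0 with subst (λ k → IWalk k z v) dv≡0 (geodesic v)
  ... | nil _ = refl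

  dist-edge : T (A x y) → d y ≤ suc (d x)
  dist-edge e = dist-≤ (geodesic _ ▻ e)

  avoids-far : IWalk j z a → (w : IWalk k a c) → j + k < d x → Avoids x w
  avoids-far {j} wa (nil a)             j+0<dx refl = <-irrefl refl
    (≤-<-trans (≤-trans (dist-≤ wa) (m≤m+n j 0)) j+0<dx)
  avoids-far {j} {x = x} wa (_◅_ {k = k} e w) j+k<dx =
    (λ { refl → <-irrefl refl (≤-<-trans (≤-trans (dist-≤ wa) (m≤m+n j (suc k))) j+k<dx) }) ,
    avoids-far (wa ▻ e) w (subst (_< d x) (+-suc j k) j+k<dx)

  adjacent⇒dist≢ : T (A x y) → d x ≢ d y
  adjacent⇒dist≢ {x} {y} e dx≡dy = go (d y) refl
    where
    go : ∀ m → d y ≡ m → ⊥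
    go zero dy≡0 =
      adjacent⇒≢ A A-irrefl e (trans (dist≡0⇒root (trans dx≡dy dy≡0)) (sym (dist≡0⇒root dy≡0)))
    go (suc k) dy≡1+k with unsnoc (subst (λ m → IWalk m z y) dy≡1+k (geodesic y))
                         | unsnoc (subst (λ m → IWalk m z x) (trans dx≡dy dy≡1+k) (geodesic x))
    ... | py , to-py , py-y | px , to-px , px-x =
      acyclic⇒noDetour acyclic (flipEdge e) (flipEdge py-y) x≢py (reverse (to-px ▻ px-x) ++ to-py)
        (avoids-++ _ to-py
          (avoids-reverse _ (avoids-▻ to-px px-x (avoids-far (nil z) to-px k<dy) (adjacent⇒≢ A A-irrefl e)))
          (avoids-far (nil z) to-py k<dy))
      where
      k<dy : k < d y
      k<dy = subst (k <_) (sym dy≡1+k) (n<1+n k)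
      x≢py : x ≢ py
      x≢py refl = 1+n≰n (subst (_≤ k) (trans dx≡dy dy≡1+k) (dist-≤ to-py))

  parent-unique : T (A x a) → T (A x c) → d a < d x → d c < d x → a ≡ c
  parent-unique {x} {a} {c} xa xc a<x c<x with a ≟ᶠ c
  ... | yes a≡c = a≡c
  ... | no  a≢c = ⊥-elim (acyclic⇒noDetour acyclic xa xc a≢c (reverse (geodesic a) ++ geodesic c)
                    (avoids-++ _ _ (avoids-reverse _ (avoids-far (nil z) (geodesic a) a<x))
                                   (avoids-far (nil z) (geodesic c) c<x)))

  child-dist : IsChild A d u x → d x ≡ suc (d u)
  child-dist (e , u<x) = ≤-antisym (dist-edge e) u<x

  nonChild⇒parent : T (A u y) → ¬ d u < d y → d y < d u
  nonChild⇒parent e u≮y = ≤∧≢⇒< (≮⇒≥ u≮y) (adjacent⇒dist≢ e ∘ sym)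

  grandchild : IsChild A d u x → T (A x y) → y ≢ u → IsChild A d x y
  grandchild {u} {x} {y} (ux , u<x) xy y≢u with d x <? d y
  ... | yes x<y = xy , x<y
  ... | no  x≮y = ⊥-elim (y≢u (parent-unique xy (flipEdge ux) (nonChild⇒parent xy x≮y) u<x))

  geodesic-descends : (w : IWalk k a v) → d a + k ≡ d v →
                      ∀ i → d (vertexAt w (inject₁ i)) < d (vertexAt w (suc i))
  geodesic-descends {a = a} {v} (_◅_ {k = k} {b = b} e w) da+k≡dv = λ
    { zero    → subst (λ c → d a < d c) (sym (vertexAt-first w)) a<b
    ; (suc i) → geodesic-descends w db+k≡dv i }
    where
    through-b : d v ≤ d b + k
    through-b = dist-≤ (geodesic b ++ w)
    via-a : suc (d a) + k ≡ d v
    via-a = trans (sym (+-suc (d a) k)) da+k≡dv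
    a<b : d a < d b
    a<b = +-cancelʳ-≤ k (suc (d a)) (d b) (≤-trans (≤-reflexive via-a) through-b)
    db+k≡dv : d b + k ≡ d v
    db+k≡dv = ≤-antisym (≤-trans (+-monoˡ-≤ k (dist-edge e)) (≤-reflexive via-a)) through-b

  dist≤height : ∀ {h} → IsHeight A d z h → ∀ v → d v ≤ h
  dist≤height (_ , longest) v = longest (d v)
    (vertexAt (geodesic v) , vertexAt-first (geodesic v) ,
     λ i → vertexAt-edge (geodesic v) i , geodesic-descends (geodesic v) (cong (_+ d v) dist-root) i)

-- Vertex covers

weight : (Fin n → ℕ) → Subset n → ℕ
weight c U = ∑ (λ i → if lookup U i then c i else 0)

sumˡ-tabulate : (f : Fin n → ℕ) → sumˡ (Data.List.tabulate f) ≡ ∑ f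
sumˡ-tabulate {zero}  f = refl
sumˡ-tabulate {suc n} f = cong (f zero +_) (sumˡ-tabulate (f ∘ suc))

sumOver≡weight : (U : Subset n) (c : Fin n → ℕ) → sumOver U c ≡ weight c U
sumOver≡weight {n} U c = trans (cong sumˡ (List.map-tabulate (λ i → i) f)) (sumˡ-tabulate f)
  where
  f : Fin n → ℕ
  f i = if lookup U i then c i else 0

∣∣≡weight : (U : Subset n) → ∣ U ∣ ≡ weight (λ _ → 1) U
∣∣≡weight []          = refl
∣∣≡weight (true  ∷ U) = cong suc (∣∣≡weight U)
∣∣≡weight (false ∷ U) = ∣∣≡weight U

weight-update : (c : Fin n → ℕ) (U : Subset n) (i : Fin n) (b : Bool) →
                weight c (U [ i ]≔ b) + (if lookup U i then c i else 0) ≡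
                weight c U + (if b then c i else 0)
weight-update c U i b = begin
  weight c (U [ i ]≔ b) + (if lookup U i then c i else 0)
    ≡⟨ ∑-agree-off _ _ i (λ j j≢i → cong (λ b′ → if b′ then c j else 0) (lookup∘update′ j≢i U b)) ⟩
  weight c U + (if lookup (U [ i ]≔ b) i then c i else 0)
    ≡⟨ cong (λ b′ → weight c U + (if b′ then c i else 0)) (lookup∘update i U b) ⟩
  weight c U + (if b then c i else 0) ∎
  where open ≡-Reasoning

∈⇒lookup≡true : {U : Subset n} {i : Fin n} → i ∈ U → lookup U i ≡ true
∈⇒lookup≡true = []=⇒lookup

∉⇒lookup≡false : {U : Subset n} {i : Fin n} → i ∉ U → lookup U i ≡ false
∉⇒lookup≡false {U = U} {i} i∉U with lookup U i in eq
... | true  = contradiction (lookup⇒[]= i U eq) i∉U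
... | false = refl

∈-update-≢ : {U : Subset n} {i j : Fin n} {b : Bool} → i ∈ U → i ≢ j → i ∈ U [ j ]≔ b
∈-update-≢ {U = U} {i} {b = b} i∈U i≢j =
  lookup⇒[]= i _ (trans (lookup∘update′ i≢j U b) (∈⇒lookup≡true i∈U))

∈-update-self : (U : Subset n) (i : Fin n) → i ∈ U [ i ]≔ true
∈-update-self U i = lookup⇒[]= i _ (lookup∘update i U true)

exchange : Subset n → Fin n → Fin n → Subset n
exchange U u x = (U [ u ]≔ false) [ x ]≔ true

weight-remove : (c : Fin n → ℕ) {U : Subset n} {u : Fin n} → u ∈ U →
                weight c (U [ u ]≔ false) + c u ≡ weight c U
weight-remove {n} c {U} {u} u∈U = begin
  weight c R + c u                             ≡⟨ cong (λ b → weight c R + (if b then c u else 0))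
                                                       (∈⇒lookup≡true u∈U) ⟨
  weight c R + (if lookup U u then c u else 0) ≡⟨ weight-update c U u false ⟩
  weight c U + 0                               ≡⟨ +-identityʳ _ ⟩
  weight c U                                   ∎
  where
  open ≡-Reasoning
  R : Subset n
  R = U [ u ]≔ false

weight-exchange : (c : Fin n → ℕ) {U : Subset n} {u x : Fin n} → u ∈ U → x ∉ U →
                  weight c (exchange U u x) + c u ≡ weight c U + c x
weight-exchange {n} c {U} {u} {x} u∈U x∉U = begin
  weight c S + c u                                    ≡⟨ cong (_+ c u) (+-identityʳ _) ⟨
  weight c S + 0 + c u                                ≡⟨ cong (λ b → weight c S + (if b then c x else 0) + c u) x∉R ⟨
  weight c S + (if lookup R x then c x else 0) + c u  ≡⟨ cong (_+ c u) (weight-update c R x true) ⟩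
  weight c R + c x + c u                              ≡⟨ +-assoc (weight c R) (c x) (c u) ⟩
  weight c R + (c x + c u)                            ≡⟨ cong (weight c R +_) (+-comm (c x) (c u)) ⟩
  weight c R + (c u + c x)                            ≡⟨ +-assoc (weight c R) (c u) (c x) ⟨
  weight c R + c u + c x                              ≡⟨ cong (_+ c x) (weight-remove c u∈U) ⟩
  weight c U + c x                                    ∎
  where
  open ≡-Reasoning
  R : Subset n
  R = U [ u ]≔ false
  S : Subset n
  S = exchange U u x
  x∉R : lookup R x ≡ false
  x∉R with x ≟ᶠ u
  ... | yes refl = lookup∘update x U false
  ... | no  x≢u  = trans (lookup∘update′ x≢u U false) (∉⇒lookup≡false x∉U)

∣remove∣ : {U : Subset n} {u : Fin n} → u ∈ U → ∣ U [ u ]≔ false ∣ < ∣ U ∣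
∣remove∣ {n} {U} {u} u∈U = begin-strict
  ∣ R ∣                     ≡⟨ ∣∣≡weight R ⟩
  weight (λ _ → 1) R        <⟨ m<m+n _ (s≤s z≤n) ⟩
  weight (λ _ → 1) R + 1    ≡⟨ weight-remove (λ _ → 1) u∈U ⟩
  weight (λ _ → 1) U        ≡⟨ ∣∣≡weight U ⟨
  ∣ U ∣                     ∎
  where
  open ≤-Reasoning
  R : Subset n
  R = U [ u ]≔ false

∣exchange∣ : {U : Subset n} {u x : Fin n} → u ∈ U → x ∉ U → ∣ exchange U u x ∣ ≡ ∣ U ∣
∣exchange∣ {U = U} {u} {x} u∈U x∉U = begin
  ∣ exchange U u x ∣               ≡⟨ ∣∣≡weight (exchange U u x) ⟩
  weight (λ _ → 1) (exchange U u x) ≡⟨ +-cancelʳ-≡ 1 _ _ (weight-exchange (λ _ → 1) u∈U x∉U) ⟩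
  weight (λ _ → 1) U               ≡⟨ ∣∣≡weight U ⟨
  ∣ U ∣                            ∎
  where open ≡-Reasoning

sumOver-exchange : (c : Fin n → ℕ) {U : Subset n} {u x : Fin n} → u ∈ U → x ∉ U → c x < c u →
                   sumOver (exchange U u x) c < sumOver U c
sumOver-exchange {n} c {U} {u} {x} u∈U x∉U x<u = +-cancelʳ-< (c u) _ _ (begin-strict
  sumOver S c + c u   ≡⟨ cong (_+ c u) (sumOver≡weight S c) ⟩
  weight c S + c u    ≡⟨ weight-exchange c u∈U x∉U ⟩
  weight c U + c x    <⟨ +-monoʳ-< (weight c U) x<u ⟩
  weight c U + c u    ≡⟨ cong (_+ c u) (sumOver≡weight U c) ⟨
  sumOver U c + c u   ∎)
  where
  open ≤-Reasoning
  S : Subset n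
  S = exchange U u x

module VertexCovers {t} (A : Adj t) (A-sym : ∀ u v → A u v ≡ A v u) (A-irrefl : ∀ u → A u u ≡ false)
  where

  private
    variable
      U U′ : Subset t
      u x : Fin t

  cover-transfer : IsVertexCover A U → (∀ p → p ∈ U → p ∈ U′ ⊎ (∀ q → T (A p q) → q ∈ U′)) →
                   IsVertexCover A U′
  cover-transfer U-cover kept p q e with U-cover p q e
  ... | inj₁ p∈U with kept p p∈U
  ...   | inj₁ p∈U′ = inj₁ p∈U′
  ...   | inj₂ p⊆U′ = inj₂ (p⊆U′ q e)
  cover-transfer U-cover kept p q e | inj₂ q∈U with kept q q∈U
  ...   | inj₁ q∈U′ = inj₂ q∈U′
  ...   | inj₂ q⊆U′ = inj₁ (q⊆U′ p (subst T (A-sym p q) e))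

  remove-cover : IsVertexCover A U → (∀ y → T (A u y) → y ∈ U) → IsVertexCover A (U [ u ]≔ false)
  remove-cover {U} {u} U-cover u⊆U = cover-transfer U-cover kept
    where
    kept : ∀ p → p ∈ U → p ∈ U [ u ]≔ false ⊎ (∀ q → T (A p q) → q ∈ U [ u ]≔ false)
    kept p p∈U with p ≟ᶠ u
    ... | yes refl = inj₂ λ q e → ∈-update-≢ (u⊆U q e) (adjacent⇒≢ A A-irrefl e ∘ sym)
    ... | no  p≢u  = inj₁ (∈-update-≢ p∈U p≢u)

  exchange-cover : IsVertexCover A U → (∀ y → T (A u y) → y ≢ x → y ∈ U) →
                   IsVertexCover A (exchange U u x)
  exchange-cover {U} {u} {x} U-cover u⊆U = cover-transfer U-cover kept
    where
    stays : ∀ {p} → p ∈ U → p ≢ u → p ∈ exchange U u x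
    stays {p} p∈U p≢u with p ≟ᶠ x
    ... | yes refl = ∈-update-self _ x
    ... | no  p≢x  = ∈-update-≢ (∈-update-≢ p∈U p≢u) p≢x
    kept : ∀ p → p ∈ U → p ∈ exchange U u x ⊎ (∀ q → T (A p q) → q ∈ exchange U u x)
    kept p p∈U with p ≟ᶠ u
    ... | no  p≢u  = inj₁ (stays p∈U p≢u)
    ... | yes refl = inj₂ λ q e → case q ≟ᶠ x of λ
      { (yes refl) → ∈-update-self _ x
      ; (no q≢x)   → stays (u⊆U q e q≢x) (adjacent⇒≢ A A-irrefl e ∘ sym) }

module OptimalCover {t} (Tr : Graph t) (acyclic : ¬ HasCycle (adj Tr))
                    (z : Fin t) (d : Fin t → ℕ) (d-dist : IsDistFrom (adj Tr) z d)
                    (U : Subset t) (U-smallest : IsSmallestVertexCover (adj Tr) U)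
                    (U-minimal : ∀ U′ → IsSmallestVertexCover (adj Tr) U′ → sumOver U d ≤ sumOver U′ d) where

  private
    A : Adj t
    A = adj Tr

  open RootedTree A (Graph.sym Tr) (irrefl Tr) acyclic z d d-dist
  open VertexCovers A (Graph.sym Tr) (irrefl Tr)

  neighbours⊈U : ∀ {u} → u ∈ U → ¬ (∀ y → T (A u y) → y ∈ U)
  neighbours⊈U u∈U covered =
    <⇒≱ (∣remove∣ u∈U) (proj₂ U-smallest _ (remove-cover (proj₁ U-smallest) covered))

  neighbours-except⊈U : ∀ {u x} → u ∈ U → x ∉ U → d x < d u → ¬ (∀ y → T (A u y) → y ≢ x → y ∈ U)
  neighbours-except⊈U {u} {x} u∈U x∉U x<u covered =
    <⇒≱ (sumOver-exchange d u∈U x∉U x<u) (U-minimal (exchange U u x) exchange-smallest)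
    where
    exchange-smallest : IsSmallestVertexCover A (exchange U u x)
    exchange-smallest = exchange-cover (proj₁ U-smallest) covered ,
      λ U′ U′-cover → subst (_≤ ∣ U′ ∣) (sym (∣exchange∣ u∈U x∉U)) (proj₂ U-smallest U′ U′-cover)

  -- If no child of u lies outside U, every neighbour of u outside U is its unique parent.
  uncoveredChild : ∀ {u} → u ∈ U → ∃ λ x → IsChild A d u x × x ∉ U
  uncoveredChild {u} u∈U with any? (λ x → (T? (A u x) ×-dec d u <? d x) ×-dec ¬? (x ∈? U))
  ... | yes found           = found
  ... | no noUncoveredChild = ⊥-elim (neighbours⊈U u∈U covered)
    where
    parent : ∀ {y} → T (A u y) → y ∉ U → d y < d u
    parent uy y∉U = nonChild⇒parent uy (λ u<y → noUncoveredChild (_ , (uy , u<y) , y∉U))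
    others-covered : ∀ {x} → T (A u x) → x ∉ U → ∀ y → T (A u y) → y ≢ x → y ∈ U
    others-covered ux x∉U y uy y≢x = decidable-stable (y ∈? U) λ y∉U →
      y≢x (parent-unique uy ux (parent uy y∉U) (parent ux x∉U))
    covered : ∀ y → T (A u y) → y ∈ U
    covered y uy = decidable-stable (y ∈? U) λ y∉U →
      neighbours-except⊈U u∈U y∉U (parent uy y∉U) (others-covered uy y∉U)

-- The T-process

processStep-adds : ∀ {t} (H : Adj t) (A : Adj n) {a b : Fin n} {ψ : Fin t → Fin n} → a ≢ b →
                   IsEmbedding H (addEdge A a b) ψ → (IsEmbedding H A ψ → T (A a b)) →
                   T (processStep H A a b)
processStep-adds H A {a} {b} a≢b ψ-emb ψ-emb⇒ab with T? (A a b)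
... | yes ab = from T-∨ (inj₁ ab)
... | no ¬ab = from T-∨ (inj₂ (from T-∧ (from T-not (a≢b ∘ to T-==ᶠ) ,
                 <⇒<ᵇ (nCopies-addEdge H A ψ-emb (¬ab ∘ ψ-emb⇒ab)))))

process-mono : ∀ {t} (H : Adj t) (A : Adj n) {i j} → i ≤ j → ∀ x y →
               T (process H A i x y) → T (process H A j x y)
process-mono H A {i} {j} i≤j x y e with ≤⇒≤′ i≤j
... | ≤′-refl       = e
... | ≤′-step i≤′j  = from T-∨ (inj₁ (process-mono H A (≤′⇒≤ i≤′j) x y e))

Joined : Adj n → Fin n → Fin n → Set
Joined B a b = T (B a b) × T (B b a)

addEdge-joins : (B : Adj n) (a b : Fin n) → Joined (addEdge B a b) a b
addEdge-joins B a b =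
  from (T-∨ {B a b}) (inj₂ (from (T-∨ {(a ==ᶠ a) ∧ (b ==ᶠ b)}) (inj₁ (from T-∧ (==ᶠ-refl a , ==ᶠ-refl b))))) ,
  from (T-∨ {B b a}) (inj₂ (from (T-∨ {(b ==ᶠ a) ∧ (a ==ᶠ b)}) (inj₂ (from T-∧ (==ᶠ-refl b , ==ᶠ-refl a)))))
  where
  ==ᶠ-refl : (x : Fin n) → T (x ==ᶠ x)
  ==ᶠ-refl x = from (T-==ᶠ {x = x}) refl

redirect : ∀ {t} → (Fin t → Fin n) → Fin t → Fin n → Fin t → Fin n
redirect φ x w y with y ≟ᶠ x
... | yes _ = w
... | no  _ = φ y

redirect-here : ∀ {t} (φ : Fin t → Fin n) x w → redirect φ x w x ≡ w
redirect-here φ x w with x ≟ᶠ x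
... | yes _   = refl
... | no  x≢x = contradiction refl x≢x

redirect-elsewhere : ∀ {t} (φ : Fin t → Fin n) {x} w {y} → y ≢ x → redirect φ x w y ≡ φ y
redirect-elsewhere φ {x} w {y} y≢x with y ≟ᶠ x
... | yes y≡x = contradiction y≡x y≢x
... | no  _   = refl

-- Moving x to w turns the copy φ into a copy that uses the edge φ(u)w and otherwise only
-- edges of B.
module _ {t n} (H : Adj t) (H-sym : ∀ u v → H u v ≡ H v u) (H-irrefl : ∀ u → H u u ≡ false)
         (B : Adj n) {φ : Fin t → Fin n} (φ-emb : IsEmbedding H B φ)
         {u x : Fin t} {w : Fin n} (w∉φ : ∀ y → φ y ≢ w) (ux : T (H u x))
         (joined : ∀ y → T (H x y) → y ≢ u → Joined B (φ y) w) where

  private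
    ψ : Fin t → Fin n
    ψ = redirect φ x w

    data View (y : Fin t) : Set where
      at-x  : y ≡ x → ψ y ≡ w → View y
      off-x : y ≢ x → ψ y ≡ φ y → View y

    view : ∀ y → View y
    view y with y ≟ᶠ x
    ... | yes refl = at-x refl (redirect-here φ x w)
    ... | no  y≢x  = off-x y≢x (redirect-elsewhere φ w y≢x)

    u≢x : u ≢ x
    u≢x = adjacent⇒≢ H H-irrefl ux

    redirect-embedding : (B′ : Adj n) → (∀ a b → T (B a b) → T (B′ a b)) → Joined B′ (φ u) w →
                         IsEmbedding H B′ ψ
    redirect-embedding B′ B⊆B′ (uw , wu) = embedding inj hom
      where
      inj : Injective _≡_ _≡_ ψ
      inj {i} {j} eq with view i | view j
      ... | at-x  i≡x _  | at-x  j≡x _  = trans i≡x (sym j≡x)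
      ... | at-x  _   ψi | off-x _   ψj = contradiction (trans (sym ψj) (trans (sym eq) ψi)) (w∉φ j)
      ... | off-x _   ψi | at-x  _   ψj = contradiction (trans (sym ψi) (trans eq ψj)) (w∉φ i)
      ... | off-x _   ψi | off-x _   ψj = injective φ-emb (trans (sym ψi) (trans eq ψj))
      edge : ∀ {a b c d} → a ≡ c → b ≡ d → T (B′ c d) → T (B′ a b)
      edge refl refl e = e
      hom : ∀ i j → T (H i j) → T (B′ (ψ i) (ψ j))
      hom i j e with view i | view j
      ... | at-x refl _ | at-x refl _ = ⊥-elim (adjacent⇒≢ H H-irrefl e refl)
      ... | at-x refl ψi | off-x _ ψj with j ≟ᶠ u
      ...   | yes refl = edge ψi ψj wu
      ...   | no  j≢u  = edge ψi ψj (B⊆B′ _ _ (proj₂ (joined j e j≢u)))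
      hom i j e | off-x _ ψi | at-x refl ψj with i ≟ᶠ u
      ...   | yes refl = edge ψi ψj uw
      ...   | no  i≢u  = edge ψi ψj (B⊆B′ _ _ (proj₁ (joined i (subst T (H-sym i x) e) i≢u)))
      hom i j e | off-x _ ψi | off-x _ ψj = edge ψi ψj (B⊆B′ _ _ (homomorphic φ-emb i j e))

    ψ-edge : (B′ : Adj n) → IsEmbedding H B′ ψ → T (B′ (φ u) w)
    ψ-edge B′ ψ-emb = subst₂ (λ a b → T (B′ a b)) (redirect-elsewhere φ w u≢x) (redirect-here φ x w)
                        (homomorphic ψ-emb u x ux)

    ψ-edge′ : (B′ : Adj n) → IsEmbedding H B′ ψ → T (B′ w (φ u))
    ψ-edge′ B′ ψ-emb = subst₂ (λ a b → T (B′ a b)) (redirect-here φ x w) (redirect-elsewhere φ w u≢x)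
                         (homomorphic ψ-emb x u (subst T (H-sym u x) ux))

  processStep-joins : Joined (processStep H B) (φ u) w
  processStep-joins =
    processStep-adds H B (w∉φ u)
      (redirect-embedding _ (addEdge-⊇ B (φ u) w) (addEdge-joins B (φ u) w)) (ψ-edge B) ,
    processStep-adds H B (w∉φ u ∘ sym)
      (redirect-embedding _ (addEdge-⊇ B w (φ u)) (swap (addEdge-joins B w (φ u)))) (ψ-edge′ B)

Joined-process-mono : ∀ {t} (H : Adj t) (B : Adj n) {i j} → i ≤ j → ∀ {a b} →
                      Joined (process H B i) a b → Joined (process H B j) a b
Joined-process-mono H B i≤j (ab , ba) = process-mono H B i≤j _ _ ab , process-mono H B i≤j _ _ ba

⌈pred/2⌉≤⌊/2⌋ : ∀ r → ⌈ pred r /2⌉ ≤ ⌊ r /2⌋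
⌈pred/2⌉≤⌊/2⌋ zero    = z≤n
⌈pred/2⌉≤⌊/2⌋ (suc r) = ≤-refl

module Spreading {t n} (Tr : Graph t) (acyclic : ¬ HasCycle (adj Tr))
                 (z : Fin t) (d : Fin t → ℕ) (d-dist : IsDistFrom (adj Tr) z d)
                 {h : ℕ} (height : IsHeight (adj Tr) d z h)
                 (U : Subset t) (U-smallest : IsSmallestVertexCover (adj Tr) U)
                 (U-minimal : ∀ U′ → IsSmallestVertexCover (adj Tr) U′ → sumOver U d ≤ sumOver U′ d)
                 (G : Graph n) (i₀ : ℕ) {φ : Fin t → Fin n} (φ-inj : Injective _≡_ _≡_ φ)
                 (φ-edges : ∀ u v → T (adj Tr u v) → T (process (adj Tr) (adj G) i₀ (φ u) (φ v))) where

  private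
    A : Adj t
    A = adj Tr
    P : ℕ → Adj n
    P = process A (adj G)

  open RootedTree A (Graph.sym Tr) (irrefl Tr) acyclic z d d-dist
  open OptimalCover Tr acyclic z d d-dist U U-smallest U-minimal

  φ-embedding : ∀ {j} → i₀ ≤ j → IsEmbedding A (P j) φ
  φ-embedding i₀≤j = embedding φ-inj λ u v e → process-mono A (adj G) i₀≤j _ _ (φ-edges u v e)

  grandchild-height : ∀ {u x y} → IsChild A d u x → IsChild A d x y →
                      h ∸ d y ≡ pred (pred (h ∸ d u))
  grandchild-height {u} {x} {y} ux xy = begin
    h ∸ d y                  ≡⟨ cong (h ∸_) (trans (child-dist xy) (cong suc (child-dist ux))) ⟩
    h ∸ suc (suc (d u))      ≡⟨ pred[m∸n]≡m∸[1+n] h (suc (d u)) ⟨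
    pred (h ∸ suc (d u))     ≡⟨ cong pred (pred[m∸n]≡m∸[1+n] h (d u)) ⟨
    pred (pred (h ∸ d u))    ∎
    where open ≡-Reasoning

  -- x is a child of u outside U; its other neighbours are grandchildren of u, hence in U
  -- and, by induction, joined to w one step earlier.
  cover-joined : ∀ fuel {u} → u ∈ U → h ∸ d u ≤ fuel → ∀ {w} → (∀ y → φ y ≢ w) →
                 Joined (P (i₀ + ⌈ h ∸ d u /2⌉)) (φ u) w
  cover-joined fuel {u} u∈U bound {w} w∉φ with uncoveredChild u∈U
  ... | x , child@(ux , u<x) , x∉U with h ∸ d u in r≡ | fuel | bound
  ...   | zero  | _         | _ = contradiction r≡ (m>n⇒m∸n≢0 (≤-trans u<x (dist≤height height x)))
  ...   | suc r | suc fuel′ | s≤s r≤fuel′ =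
    subst (λ j → Joined (P j) (φ u) w) (sym (+-suc i₀ ⌊ r /2⌋))
      (processStep-joins A (Graph.sym Tr) (irrefl Tr) (P previous) (φ-embedding (m≤m+n i₀ _)) w∉φ ux
                         grandchildren-joined)
    where
    previous : ℕ
    previous = i₀ + ⌊ r /2⌋
    grandchildren-joined : ∀ y → T (A x y) → y ≢ u → Joined (P previous) (φ y) w
    grandchildren-joined y xy y≢u = Joined-process-mono A (adj G) (+-monoʳ-≤ i₀ level≤)
      (cover-joined fuel′ y∈U (subst (_≤ fuel′) (sym y-left) (≤-trans pred[n]≤n r≤fuel′)) w∉φ)
      where
      y-left : h ∸ d y ≡ pred r
      y-left = trans (grandchild-height child (grandchild child xy y≢u)) (cong (pred ∘ pred) r≡)
      level≤ : ⌈ h ∸ d y /2⌉ ≤ ⌊ r /2⌋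
      level≤ = subst (λ m → ⌈ m /2⌉ ≤ ⌊ r /2⌋) (sym y-left) (⌈pred/2⌉≤⌊/2⌋ r)
      y∈U : y ∈ U
      y∈U with proj₁ U-smallest x y xy
      ... | inj₁ x∈U = contradiction x∈U x∉U
      ... | inj₂ y∈U = y∈U

mainTheorem9 : ∀ {t n : ℕ} (Tr : Graph t) → IsTree Tr →
    (z : Fin t) → ¬ IsLeaf (adj Tr) z →
    (d : Fin t → ℕ) → IsDistFrom (adj Tr) z d →
    (h : ℕ) → IsHeight (adj Tr) d z h →
    (U : Subset t) → IsSmallestVertexCover (adj Tr) U →
    (∀ (U' : Subset t) → IsSmallestVertexCover (adj Tr) U' → sumOver U d ≤ sumOver U' d) →
    (G : Graph n) → (i₀ : ℕ) →
    (φ : Fin t → Fin n) → Injective _≡_ _≡_ φ →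
    (∀ u v → T (adj Tr u v) → T (process (adj Tr) (adj G) i₀ (φ u) (φ v))) →
    ∀ (u : Fin t) → u ∈ U →
    ∀ (w : Fin n) → (∀ x → φ x ≢ w) →
    T (process (adj Tr) (adj G) (i₀ + ⌈ h /2⌉) (φ u) w)
mainTheorem9 Tr (_ , acyclic) z _ d d-dist h height U U-smallest U-minimal
             G i₀ φ φ-inj φ-edges u u∈U w w∉φ =
  process-mono (adj Tr) (adj G) (+-monoʳ-≤ i₀ (⌈n/2⌉-mono (m∸n≤m h (d u)))) (φ u) w
    (proj₁ (cover-joined (h ∸ d u) u∈U ≤-refl w∉φ))
  where open Spreading Tr acyclic z d d-dist height U U-smallest U-minimal G i₀ φ-inj φ-edges
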